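{- Let $F$ be a DQBF in prenex conjunctive normal form and let $\varphi$ be an autarky for $F$. Let $F[\varphi]$ be the DQBF with the same quantifier prefix as $F$ obtained from $F$ by removing every clause that is touched (and hence satisfied) by $\varphi$. Then $F[\varphi]$ is satisfiable if and only if $F$ is satisfiable.
   Context: A DQBF (dependency quantified Boolean formula) in CNF has the form $\forall x_1,\dots,x_n\,\exists y_1(D_1)\cdots\exists y_m(D_m): F_0$, where the $x_i$ are universal variables, the $y_j$ are existential variables, each dependency set $D_j\subseteq\{x_1,\dots,x_n\}$, and the matrix $F_0$ is a propositional formula in CNF (a set of clauses) over these variables. $F$ is satisfiable if there exist Boolean functions $f_j$, where $f_j$ depends only on the variables in $D_j$, such that substituting $f_j$ for $y_j$ for all $j$ makes $F_0$ a tautology (true under every assignment of the universal variables). An autarky for $F$ is a partial assignment $\varphi$ to the existential variables which assigns to each variable $y_j$ in its domain a Boolean function of the universal variables in $D_j$, such that every clause of $F_0$ that is touched by $\varphi$ (i.e. contains a variable in the domain of $\varphi$) becomes a tautology after substituting the assigned functions for the assigned variables. -}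

module Defs where

open import Data.Nat using (ℕ)
open import Data.Fin using (Fin)
open import Data.Bool using (Bool; true; false; not; _∧_; _∨_; if_then_else_)
open import Data.List using (List; filter)
open import Data.Bool.ListAction using (any; all)
open import Data.Maybe using (Maybe; just; nothing; is-just)
open import Data.Product using (Σ; _×_)
open import Relation.Binary.PropositionalEquality using (_≡_)
open import Relation.Nullary.Decidable using (¬?)
open import Data.Bool using (T?)

data Var (n m : ℕ) : Set where
  univ  : Fin n → Var n m
  exist : Fin m → Var n m

-- A literal: polarity (true = positive, false = negated) and a variable.
record Literal (n m : ℕ) : Set where
  constructor lit
  field
    pos : Bool
    var : Var n m

Clause : ℕ → ℕ → Set
Clause n m = List (Literal n m)

CNF : ℕ → ℕ → Set
CNF n m = List (Clause n m)

UAssign : ℕ → Set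
UAssign n = Fin n → Bool

-- A DQBF  ∀ x₁..xₙ ∃ y₁(D₁)..∃ yₘ(Dₘ) : F₀ .
-- dep j i ≡ true  iff  xᵢ ∈ Dⱼ.
record DQBF (n m : ℕ) : Set where
  constructor dqbf
  field
    dep    : Fin m → Fin n → Bool
    matrix : CNF n m

DependsOnly : {n : ℕ} → (Fin n → Bool) → (UAssign n → Bool) → Set
DependsOnly {n} D f =
  (α β : UAssign n) → ((i : Fin n) → D i ≡ true → α i ≡ β i) → f α ≡ f β

evalLit : {n m : ℕ} → UAssign n → (Fin m → Bool) → Literal n m → Bool
evalLit α e (lit p (univ i))  = if p then α i else not (α i)
evalLit α e (lit p (exist j)) = if p then e j else not (e j)

evalClause : {n m : ℕ} → UAssign n → (Fin m → Bool) → Clause n m → Bool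
evalClause α e C = any (evalLit α e) C

evalCNF : {n m : ℕ} → UAssign n → (Fin m → Bool) → CNF n m → Bool
evalCNF α e F = all (evalClause α e) F

Satisfiable : {n m : ℕ} → DQBF n m → Set
Satisfiable {n} {m} F =
  Σ (Fin m → UAssign n → Bool) λ f →
    ((j : Fin m) → DependsOnly (DQBF.dep F j) (f j)) ×
    ((α : UAssign n) → evalCNF α (λ j → f j α) F.matrix ≡ true)
  where module F = DQBF F

-- Partial assignment of existential variables to Boolean functions of the
-- universals (nothing = not in the domain).
PartialAssign : ℕ → ℕ → Set
PartialAssign n m = Fin m → Maybe (UAssign n → Bool)

touchesLit : {n m : ℕ} → PartialAssign n m → Literal n m → Bool
touchesLit φ (lit p (univ i))  = false
touchesLit φ (lit p (exist j)) = is-just (φ j)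

touches : {n m : ℕ} → PartialAssign n m → Clause n m → Bool
touches φ C = any (touchesLit φ) C

substVal : {n m : ℕ} → PartialAssign n m → UAssign n → (Fin m → Bool) → Fin m → Bool
substVal φ α τ j with φ j
... | just f  = f α
... | nothing = τ j

IsAutarky : {n m : ℕ} → DQBF n m → PartialAssign n m → Set
IsAutarky {n} {m} F φ =
  ((j : Fin m) (f : UAssign n → Bool) → φ j ≡ just f → DependsOnly (DQBF.dep F j) f) ×
  ((C : Clause n m) → C Data.List.Membership.Propositional.∈ DQBF.matrix F → touches φ C ≡ true →
     (α : UAssign n) (τ : Fin m → Bool) → evalClause α (substVal φ α τ) C ≡ true)
  where import Data.List.Membership.Propositional

reduce : {n m : ℕ} → DQBF n m → PartialAssign n m → DQBF n m
reduce F φ = dqbf (DQBF.dep F) (filter (λ C → ¬? (T? (touches φ C))) (DQBF.matrix F))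

-- Substituting the autarky's functions into a Skolem model of F[φ] gives a
-- Skolem model of F: the clauses touched by φ become tautologies, and the
-- untouched ones do not see the substitution. Conversely, F[φ] is a subset of
-- the clauses of F, so every model of F is one of F[φ].
module Submission where

open import Defs
open import Level using (Level)
open import Data.Nat using (ℕ)
open import Data.Fin using (Fin)
open import Data.Bool using (Bool; true; false; T; _∨_)
open import Data.Bool.Properties using (T-≡; ∨-conicalˡ; ∨-conicalʳ)
open import Data.List using ([]; _∷_; filter)
open import Data.List.Membership.Propositional using (_∈_)
open import Data.List.Membership.Propositional.Properties using (∈-filter⁺)
open import Data.List.Relation.Binary.Subset.Propositional.Properties using (filter-⊆)
open import Data.List.Relation.Unary.All as All using (lookup)
open import Data.List.Relation.Unary.All.Properties using (all⁺; all⁻; all-anti-mono)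
open import Data.Maybe using (just; nothing)
open import Data.Product using (_×_; _,_)
open import Function using (_∘_; Equivalence)
open import Relation.Binary.PropositionalEquality using (_≡_; refl; sym; cong₂; subst)
open import Relation.Nullary.Decidable using (Dec)
open import Relation.Unary using (Pred)

open Equivalence using (to; from)

evalCNF-filter : {n m : ℕ} {ℓ : Level} {P : Pred (Clause n m) ℓ} (P? : (C : Clause n m) → Dec (P C))
  (α : UAssign n) (e : Fin m → Bool) (M : CNF n m) →
  evalCNF α e M ≡ true → evalCNF α e (filter P? M) ≡ true
evalCNF-filter P? α e M =
  to T-≡ ∘ all-anti-mono (evalClause α e) (filter-⊆ P? M) ∘ from T-≡

module _ {n m : ℕ} (φ : PartialAssign n m) (α : UAssign n) (τ : Fin m → Bool) where

  evalLit-substVal-untouched : (l : Literal n m) → touchesLit φ l ≡ false →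
    evalLit α (substVal φ α τ) l ≡ evalLit α τ l
  evalLit-substVal-untouched (lit p (univ i))  _ = refl
  evalLit-substVal-untouched (lit p (exist j)) untouched with φ j
  ... | nothing = refl

  evalClause-substVal-untouched : (C : Clause n m) → touches φ C ≡ false →
    evalClause α (substVal φ α τ) C ≡ evalClause α τ C
  evalClause-substVal-untouched []      _         = refl
  evalClause-substVal-untouched (l ∷ C) untouched = cong₂ _∨_
    (evalLit-substVal-untouched l (∨-conicalˡ (touchesLit φ l) (touches φ C) untouched))
    (evalClause-substVal-untouched C (∨-conicalʳ (touchesLit φ l) (touches φ C) untouched))

evalCNF-substVal-autarky : {n m : ℕ} (F : DQBF n m) (φ : PartialAssign n m) →
  IsAutarky F φ → (α : UAssign n) (τ : Fin m → Bool) →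
  evalCNF α τ (DQBF.matrix (reduce F φ)) ≡ true →
  evalCNF α (substVal φ α τ) (DQBF.matrix F) ≡ true
evalCNF-substVal-autarky {n} {m} F φ (_ , touched-tautology) α τ reduced-true =
  to T-≡ (all⁻ (evalClause α (substVal φ α τ)) (All.tabulate satisfied))
  where
  reduced-clauses-true : All.All (T ∘ evalClause α τ) (DQBF.matrix (reduce F φ))
  reduced-clauses-true = all⁺ (evalClause α τ) _ (from T-≡ reduced-true)

  satisfied : {C : Clause n m} → C ∈ DQBF.matrix F → T (evalClause α (substVal φ α τ) C)
  satisfied {C} C∈F with touches φ C in touched
  ... | true  = from T-≡ (touched-tautology C C∈F touched α τ)
  ... | false = subst T (sym (evalClause-substVal-untouched φ α τ C touched))
                  (lookup reduced-clauses-true (∈-filter⁺ _ C∈F (subst T touched)))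

substSkolem : {n m : ℕ} → PartialAssign n m → (Fin m → UAssign n → Bool) →
  Fin m → UAssign n → Bool
substSkolem φ f j α = substVal φ α (λ k → f k α) j

substSkolem-dependsOnly : {n m : ℕ} (F : DQBF n m) (φ : PartialAssign n m) →
  IsAutarky F φ → (f : Fin m → UAssign n → Bool) →
  ((j : Fin m) → DependsOnly (DQBF.dep F j) (f j)) →
  (j : Fin m) → DependsOnly (DQBF.dep F j) (substSkolem φ f j)
substSkolem-dependsOnly F φ (assigned-dependsOnly , _) f f-dependsOnly j α β α≈β
  with φ j in assigned
... | just g  = assigned-dependsOnly j g assigned α β α≈β
... | nothing = f-dependsOnly j α β α≈β

lemma1 : {n m : ℕ} (F : DQBF n m) (φ : PartialAssign n m) → IsAutarky F φ →
    (Satisfiable (reduce F φ) → Satisfiable F) × (Satisfiable F → Satisfiable (reduce F φ))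
lemma1 F φ autarky = reduced⇒original , original⇒reduced
  where
  reduced⇒original : Satisfiable (reduce F φ) → Satisfiable F
  reduced⇒original (f , f-dependsOnly , f-model) =
    substSkolem φ f ,
    substSkolem-dependsOnly F φ autarky f f-dependsOnly ,
    λ α → evalCNF-substVal-autarky F φ autarky α (λ j → f j α) (f-model α)

  original⇒reduced : Satisfiable F → Satisfiable (reduce F φ)
  original⇒reduced (f , f-dependsOnly , f-model) =
    f , f-dependsOnly , λ α → evalCNF-filter _ α (λ j → f j α) (DQBF.matrix F) (f-model α)
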